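{- Let $\delta\colon\subseteq\mathbb{N}^{\mathbb{N}}\to X$ be a representation. Assume that there exists a continuous map $F\colon\operatorname{dom}(\delta)\to(\operatorname{dom}(\delta))^{\mathbb{N}}$ such that for all $p\in\operatorname{dom}(\delta)$ the sequence $F(p)$ is dense in $\delta^{ -1}(\delta(p))$. Then $\delta$ is an open map.
   Context: $\mathbb{N}^{\mathbb{N}}$ carries the product (Baire) topology; $\operatorname{dom}(\delta)$ carries the subspace topology and $(\operatorname{dom}(\delta))^{\mathbb{N}}$ the product topology. A representation of a set $X$ is a partial surjection $\delta\colon\subseteq\mathbb{N}^{\mathbb{N}}\to X$; $X$ carries the final topology of $\delta$ ($U\subseteq X$ open iff $\delta^{ -1}(U)$ is open in $\operatorname{dom}(\delta)$). $\delta$ is open if it maps open subsets of $\operatorname{dom}(\delta)$ to open subsets of $X$. -}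

module Defs where

open import Data.Nat using (ℕ; _<_)
open import Data.Product using (Σ; ∃; ∃-syntax; _×_; _,_; proj₁)
open import Relation.Binary.PropositionalEquality using (_≡_)
open import Level using (Level; _⊔_) renaming (suc to lsuc; zero to lzero)

Baire : Set
Baire = ℕ → ℕ

_≈[_]_ : Baire → ℕ → Baire → Set
p ≈[ n ] q = ∀ i → i < n → p i ≡ q i

BaireOpen : (Baire → Set) → Set
BaireOpen V = ∀ p → V p → ∃[ n ] (∀ q → q ≈[ n ] p → V q)

-- A representation δ :⊆ ℕ^ℕ → X: a partial surjection.
-- dom(δ) is the subset given by the predicate Dom; δ is a function on it
-- whose value does not depend on the domain-membership witness.
record Representation (X : Set) : Set₁ where
  field
    Dom   : Baire → Set
    δ     : (p : Baire) → Dom p → X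
    δ-irr : ∀ p (d d′ : Dom p) → δ p d ≡ δ p d′
    surj  : ∀ (x : X) → ∃[ p ] Σ (Dom p) (λ d → δ p d ≡ x)

module _ {X : Set} (ρ : Representation X) where
  open Representation ρ

  D : Set
  D = Σ Baire Dom

  δ̂ : D → X
  δ̂ (p , d) = δ p d

  DomOpen : (D → Set) → Set₁
  DomOpen U = Σ (Baire → Set) λ V →
    BaireOpen V × (∀ (x : D) → (U x → V (proj₁ x)) × (V (proj₁ x) → U x))

  -- product topology on dom(δ)^ℕ: W is open iff it is a union of basic
  -- open sets ∏_{i<k} U_i × ∏_{i≥k} dom(δ) with each U_i open in dom(δ)
  SeqOpen : ((ℕ → D) → Set) → Set₁
  SeqOpen W = ∀ s → W s → ∃[ k ] Σ (ℕ → D → Set) λ U →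
      (∀ i → DomOpen (U i))
    × (∀ i → i < k → U i (s i))
    × (∀ t → (∀ i → i < k → U i (t i)) → W t)

  Continuous : (D → (ℕ → D)) → Set₁
  Continuous F = ∀ W → SeqOpen W → DomOpen (λ x → W (F x))

  Fibre : D → D → Set
  Fibre p q = δ̂ q ≡ δ̂ p

  -- the sequence s lies in and is dense in the subspace A ⊆ dom(δ):
  -- every open set of A (trace of an open set of dom(δ)) that is
  -- inhabited meets the sequence
  DenseIn : (ℕ → D) → (D → Set) → Set₁
  DenseIn s A = (∀ k → A (s k))
    × (∀ (U : D → Set) → DomOpen U → ∀ q → A q → U q → ∃[ k ] U (s k))

  -- final topology on X induced by δ
  XOpen : (X → Set) → Set₁
  XOpen O = DomOpen (λ x → O (δ̂ x))

  IsOpenMap : Set₁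
  IsOpenMap = ∀ (U : D → Set) → DomOpen U →
    XOpen (λ y → Σ D λ x → U x × δ̂ x ≡ y)

-- For U open in dom(δ), its saturation δ⁻¹(δ(U)) consists of exactly those x
-- whose sequence F(x) meets U: every F(x)ₖ lies in the fibre of x, and F(x)
-- is dense in that fibre. So δ⁻¹(δ(U)) is the preimage under the continuous F
-- of the open set ⋃ₖ {s | sₖ ∈ U} of dom(δ)^ℕ, hence open; by the definition
-- of the final topology, δ(U) is open in X.
module Submission where

open import Defs
open import Data.Nat using (ℕ; suc; _≟_)
open import Data.Nat.Properties using (≤-refl)
open import Data.Product using (Σ; _×_; _,_; proj₁; proj₂; ∃-syntax)
open import Relation.Binary.PropositionalEquality using (_≡_; refl)
open import Relation.Nullary using (Dec; yes; no; contradiction)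
open import Relation.Unary using (_≐_)

BaireOpen-⇒ : {P : Set} {V : Baire → Set} → Dec P → BaireOpen V →
  BaireOpen (λ p → P → V p)
BaireOpen-⇒ (yes P) V-open p P⇒Vp with V-open p (P⇒Vp P)
... | n , cylinder⊆V = n , λ q q≈p _ → cylinder⊆V q q≈p
BaireOpen-⇒ (no ¬P) _ _ _ = 0 , λ _ _ P → contradiction P ¬P

module _ {X : Set} (ρ : Representation X) where

  DomOpen-resp-≐ : {U U′ : D ρ → Set} → U ≐ U′ → DomOpen ρ U → DomOpen ρ U′
  DomOpen-resp-≐ (U⊆U′ , U′⊆U) (V , V-open , U⇔V) =
    V , V-open , λ x → (λ u′ → proj₁ (U⇔V x) (U′⊆U u′)) , (λ v → U⊆U′ (proj₂ (U⇔V x) v))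

  DomOpen-⇒ : {P : Set} {U : D ρ → Set} → Dec P → DomOpen ρ U →
    DomOpen ρ (λ x → P → U x)
  DomOpen-⇒ P? (V , V-open , U⇔V) =
    (λ p → _ → V p) , BaireOpen-⇒ P? V-open ,
    λ x → (λ u P → proj₁ (U⇔V x) (u P)) , (λ v P → proj₂ (U⇔V x) (v P))

  -- The basic open set uses U at coordinate k and all of dom(δ) at the
  -- coordinates i < k, encoded as the open set i ≡ k → U.
  SeqOpen-proj⁻¹ : (k : ℕ) {U : D ρ → Set} → DomOpen ρ U →
    SeqOpen ρ (λ s → U (s k))
  SeqOpen-proj⁻¹ k {U} U-open s sₖ∈U =
    suc k , (λ i x → i ≡ k → U x) , (λ i → DomOpen-⇒ (i ≟ k) U-open) ,
    (λ { _ _ refl → sₖ∈U }) , λ t t∈ → t∈ k ≤-refl refl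

  SeqOpen-⋃ : {W : ℕ → (ℕ → D ρ) → Set} → (∀ k → SeqOpen ρ (W k)) →
    SeqOpen ρ (λ s → ∃[ k ] W k s)
  SeqOpen-⋃ W-open s (k , s∈Wₖ) with W-open k s s∈Wₖ
  ... | n , U , U-open , s∈U , U⊆Wₖ = n , U , U-open , s∈U , λ t t∈U → k , U⊆Wₖ t t∈U

  saturation≐meets : {F : D ρ → ℕ → D ρ} → (∀ p → DenseIn ρ (F p) (Fibre ρ p)) →
    {U : D ρ → Set} → DomOpen ρ U →
    (λ x → ∃[ k ] U (F x k)) ≐ (λ x → Σ (D ρ) λ y → U y × δ̂ ρ y ≡ δ̂ ρ x)
  saturation≐meets {F} F-dense U-open =
    (λ { {x} (k , Fxₖ∈U) → F x k , Fxₖ∈U , proj₁ (F-dense x) k }) ,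
    (λ { {x} (y , y∈U , y∈fibre) → proj₂ (F-dense x) _ U-open y y∈fibre y∈U })

propositionA2 : {X : Set} (ρ : Representation X) →
    Σ (D ρ → (ℕ → D ρ)) (λ F → Continuous ρ F × (∀ p → DenseIn ρ (F p) (Fibre ρ p))) →
    IsOpenMap ρ
propositionA2 ρ (F , F-continuous , F-dense) U U-open =
  DomOpen-resp-≐ ρ (saturation≐meets ρ F-dense U-open)
    (F-continuous _ (SeqOpen-⋃ ρ λ k → SeqOpen-proj⁻¹ ρ k U-open))
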